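{- Let $\mathbb{A}=(a_{i_1i_2\ldots i_m})$ be a nonnegative tensor of order $m$ and dimension $n$. Suppose that for each $s\in[n]$ there is a word $\alpha_s=j^{(s)}_2j^{(s)}_3\ldots j^{(s)}_m\in[n]^{m-1}$ such that $a_{i\alpha_s}=0$ for every $i\in[n]$ and every $s\in[n]\setminus\{i\}$. Then there exist $\gamma_1,\gamma_2,\ldots,\gamma_n\in[n]^{(m-1)^2}$ such that $(\mathbb{A}^2)_{i\gamma_k}=0$ for every $i\in[n]$ and every $k\in[n]\setminus\{i\}$.
   Context: $[n]=\{1,\ldots,n\}$; for $i\in[n]$ and $\alpha=i_2\ldots i_m\in[n]^{m-1}$, $a_{i\alpha}=a_{ii_2\ldots i_m}$. General product: for $\mathbb{A}$ of order $m\ge2$ and $\mathbb{B}$ of order $k\ge1$, both of dimension $n$, $\mathbb{A}\mathbb{B}$ is the order $(m-1)(k-1)+1$ tensor with $(\mathbb{A}\mathbb{B})_{i\alpha_1\ldots\alpha_{m-1}}=\sum_{i_2,\ldots,i_m=1}^n a_{ii_2\ldots i_m}b_{i_2\alpha_1}\cdots b_{i_m\alpha_{m-1}}$ ($\alpha_j\in[n]^{k-1}$). Thus $\mathbb{A}^2=\mathbb{A}\mathbb{A}$ has order $(m-1)^2+1$ and its entries are indexed by $i\in[n]$ and $\gamma\in[n]^{(m-1)^2}$.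
   Formalization: The entries of the tensor $\mathbb{A}$ are nonnegative rationals. -}

module Defs where

open import Data.Nat using (ℕ; zero; suc; _*_; _∸_)
open import Data.Fin using (Fin)
open import Data.Vec using (Vec; []; _∷_; take; drop; zipWith; foldr′)
open import Data.List using (List; []; _∷_; concatMap; map; foldr) renaming (_++_ to _++ₗ_)
open import Data.List.Base using (allFin)
open import Data.Rational using (ℚ; 0ℚ; 1ℚ; _≤_) renaming (_+_ to _+ℚ_; _*_ to _*ℚ_)

Tensor : (m n : ℕ) → Set
Tensor m n = Fin n → Vec (Fin n) (m ∸ 1) → ℚ

Nonneg : ∀ m {n} → Tensor m n → Set
Nonneg m A = ∀ i α → 0ℚ ≤ A i α

words : (n k : ℕ) → List (Vec (Fin n) k)
words n zero = [] ∷ []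
words n (suc k) = concatMap (λ x → map (x ∷_) (words n k)) (allFin n)

sumWords : (n k : ℕ) → (Vec (Fin n) k → ℚ) → ℚ
sumWords n k f = foldr (λ w acc → f w +ℚ acc) 0ℚ (words n k)

blocks : ∀ {A : Set} (p k : ℕ) → Vec A (p * k) → Vec (Vec A k) p
blocks zero k xs = []
blocks (suc p) k xs = take k xs ∷ blocks p k (drop k xs)

prodV : ∀ {l} → Vec ℚ l → ℚ
prodV = foldr′ _*ℚ_ 1ℚ

-- Entries of A² = A A (general product), an order (m-1)²+1 tensor:
-- (A²)_{i α₁…α_{m-1}} = Σ_{i₂…i_m} a_{i i₂…i_m} b_{i₂ α₁} ⋯ b_{i_m α_{m-1}}  with B = A,
-- where γ = α₁ α₂ … α_{m-1} ∈ [n]^{(m-1)²}.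
square : ∀ m {n} → Tensor m n → Fin n → Vec (Fin n) ((m ∸ 1) * (m ∸ 1)) → ℚ
square m {n} A i γ =
  sumWords n (m ∸ 1) (λ w → A i w *ℚ prodV (zipWith A w (blocks (m ∸ 1) (m ∸ 1) γ)))

{-# OPTIONS --safe #-}
-- Take γ_k to be the concatenation α_{j₂} α_{j₃} … α_{j_m} where α_k = j₂ j₃ … j_m.
-- In the sum defining (A²)_{i γ_k}, the summand indexed by w = α_k carries the factor
-- a_{i α_k} = 0, and any other w differs from α_k in some position t, so it carries a
-- factor a_{w_t α_{j_t}} with w_t ≠ j_t, which vanishes as well.
module Submission where

open import Defs
open import Data.Nat using (ℕ; _≤_; _*_; _∸_; zero; suc)
open import Data.Fin using (Fin)
open import Data.Fin.Properties using (_≟_)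
open import Data.List using (List; []; _∷_; foldr)
open import Data.Vec using (Vec; []; _∷_; _++_; take; drop; concat; zipWith; map)
open import Data.Vec.Properties using (≡-dec; ++-injective; take++drop≡id)
open import Data.Rational using (ℚ; 0ℚ) renaming (_+_ to _+ℚ_; _*_ to _*ℚ_)
open import Data.Rational.Properties using (+-identityˡ; *-zeroˡ; *-zeroʳ)
open import Data.Product using (Σ; _×_; _,_; proj₁; proj₂)
open import Function using (_∘_)
open import Relation.Nullary using (yes; no; contradiction)
open import Relation.Binary.PropositionalEquality using (_≡_; _≢_; refl; cong; cong₂; trans; sym)

take-drop-++ : ∀ {A : Set} {k l} (xs : Vec A k) (ys : Vec A l) →
  take k (xs ++ ys) ≡ xs × drop k (xs ++ ys) ≡ ys
take-drop-++ {k = k} xs ys = ++-injective (take k (xs ++ ys)) xs (take++drop≡id k (xs ++ ys))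

blocks-concat : ∀ {A : Set} p k (xss : Vec (Vec A k) p) → blocks p k (concat xss) ≡ xss
blocks-concat zero    k []         = refl
blocks-concat (suc p) k (xs ∷ xss) =
  cong₂ _∷_ (proj₁ split) (trans (cong (blocks p k) (proj₂ split)) (blocks-concat p k xss))
  where split = take-drop-++ xs (concat xss)

x≡0⇒x*y≡0 : ∀ x y → x ≡ 0ℚ → x *ℚ y ≡ 0ℚ
x≡0⇒x*y≡0 _ y refl = *-zeroˡ y

y≡0⇒x*y≡0 : ∀ x y → y ≡ 0ℚ → x *ℚ y ≡ 0ℚ
y≡0⇒x*y≡0 x _ refl = *-zeroʳ x

sumWords-≡0 : ∀ n k (f : Vec (Fin n) k → ℚ) → (∀ w → f w ≡ 0ℚ) → sumWords n k f ≡ 0ℚ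
sumWords-≡0 n k f f≡0 = go (words n k)
  where
  go : (ws : List (Vec (Fin n) k)) → foldr (λ w acc → f w +ℚ acc) 0ℚ ws ≡ 0ℚ
  go []       = refl
  go (w ∷ ws) rewrite f≡0 w = trans (+-identityˡ _) (go ws)

OffDiagonalZero : ∀ m {n} → Tensor m n → (Fin n → Vec (Fin n) (m ∸ 1)) → Set
OffDiagonalZero m A α = ∀ i s → s ≢ i → A i (α s) ≡ 0ℚ

module _ m {n} (A : Tensor m n) (α : Fin n → Vec (Fin n) (m ∸ 1)) (A-α≡0 : OffDiagonalZero m A α) where

  prodV-zipWith-≡0 : ∀ {l} (w v : Vec (Fin n) l) → w ≢ v → prodV (zipWith A w (map α v)) ≡ 0ℚ
  prodV-zipWith-≡0 []      []      w≢v = contradiction refl w≢v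
  prodV-zipWith-≡0 (x ∷ w) (y ∷ v) w≢v with x ≟ y
  ... | yes refl = y≡0⇒x*y≡0 (A x (α x)) _ (prodV-zipWith-≡0 w v (w≢v ∘ cong (x ∷_)))
  ... | no  x≢y  = x≡0⇒x*y≡0 (A x (α y)) _ (A-α≡0 x y (x≢y ∘ sym))

  square-concat-≡0 : ∀ {i k} → k ≢ i → square m A i (concat (map α (α k))) ≡ 0ℚ
  square-concat-≡0 {i} {k} k≢i rewrite blocks-concat (m ∸ 1) (m ∸ 1) (map α (α k)) =
    sumWords-≡0 n (m ∸ 1) _ summand-≡0
    where
    summand-≡0 : ∀ w → A i w *ℚ prodV (zipWith A w (map α (α k))) ≡ 0ℚ
    summand-≡0 w with ≡-dec _≟_ w (α k)
    ... | yes refl = x≡0⇒x*y≡0 (A i (α k)) _ (A-α≡0 i k k≢i)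
    ... | no  w≢αk = y≡0⇒x*y≡0 (A i w) _ (prodV-zipWith-≡0 w (α k) w≢αk)

proposition4p1 : (m n : ℕ) → 2 ≤ m → (A : Tensor m n) → Nonneg m A →
    (α : Fin n → Vec (Fin n) (m ∸ 1)) →
    (∀ (i s : Fin n) → s ≢ i → A i (α s) ≡ 0ℚ) →
    Σ (Fin n → Vec (Fin n) ((m ∸ 1) * (m ∸ 1))) (λ γ →
      ∀ (i k : Fin n) → k ≢ i → square m A i (γ k) ≡ 0ℚ)
proposition4p1 m n _ A _ α A-α≡0 =
  (λ k → concat (map α (α k))) , λ i k k≢i → square-concat-≡0 m A α A-α≡0 k≢i
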